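{- Let $H$ and $G$ be bipartite graphs on vertex sets $\tilde U\,\dot\cup\,\tilde V$ and $U\,\dot\cup\,V$ respectively, such that $\deg_H(\tilde v)\le\Delta$ for all $\tilde v\in\tilde V$, and let $f,f'\colon\tilde V\to V$ be injective functions with switching distance $\mathrm{swdist}(f,f')\le s$. Then $\mathrm{ndist}_{\tilde U}\big(B_f(H,G),B_{f'}(H,G)\big)\le 2s\Delta$.
   Context: For an injective $f\colon\tilde V\to V$, a vertex $u\in U$ is an $f$-candidate for $\tilde u\in\tilde U$ if $f(N_H(\tilde u))\subseteq N_G(u)$; the candidate graph $B_f(H,G)$ is the bipartite graph on $\tilde U\,\dot\cup\,U$ whose edges are the pairs $\tilde uu$ with $u$ an $f$-candidate for $\tilde u$. An injective $f'$ is obtained from an injective $f$ (with the same domain) by a switching if there are $a,b$ in the domain with $f'(a)=f(b)$, $f'(b)=f(a)$ and $f'(w)=f(w)$ for all $w\notin\{a,b\}$; $\mathrm{swdist}(f,f')\le s$ means $f'$ is obtained from $f$ by a sequence of at most $s$ switchings. For bipartite graphs $B,B'$ on the same vertex set $U\,\dot\cup\,\tilde U$, $\mathrm{ndist}_{\tilde U}(B,B')$ is the number of $\tilde u\in\tilde U$ with $N_B(\tilde u)\ne N_{B'}(\tilde u)$. -}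

module Defs where

open import Data.Nat using (ℕ; zero; suc)
open import Data.Fin using (Fin)
open import Data.Bool using (Bool; true; false; not; _∨_; _xor_)
open import Data.List using (List; length; filterᵇ; allFin)
open import Data.Bool.ListAction using (all; any)
open import Data.Product using (Σ; _×_; ∃₂)
open import Relation.Binary.PropositionalEquality using (_≡_; _≢_)

-- A bipartite graph on vertex classes X ∪̇ Y with |X| = m, |Y| = n,
-- given by its (Boolean) biadjacency relation: E x y = true iff xy is an edge.
BipGraph : ℕ → ℕ → Set
BipGraph m n = Fin m → Fin n → Bool

degʳ : ∀ {m n} → BipGraph m n → Fin n → ℕ
degʳ {m} E y = length (filterᵇ (λ x → E x y) (allFin m))

-- u is an f-candidate for ũ : f(N_H(ũ)) ⊆ N_G(u), i.e. for all ṽ ∈ Ṽ,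
-- ũṽ ∈ E(H) implies u f(ṽ) ∈ E(G).
-- H on Ũ ∪̇ Ṽ (|Ũ| = a, |Ṽ| = b), G on U ∪̇ V (|U| = c, |V| = d).
isCandidate : ∀ {a b c d} → BipGraph a b → BipGraph c d → (Fin b → Fin d)
            → Fin a → Fin c → Bool
isCandidate {b = b} H G f ũ u = all (λ ṽ → not (H ũ ṽ) ∨ G u (f ṽ)) (allFin b)

candidateGraph : ∀ {a b c d} → BipGraph a b → BipGraph c d → (Fin b → Fin d)
               → BipGraph a c
candidateGraph H G f = isCandidate H G f

ndist : ∀ {a c} → BipGraph a c → BipGraph a c → ℕ
ndist {a} {c} B B' =
  length (filterᵇ (λ ũ → any (λ u → B ũ u xor B' ũ u) (allFin c)) (allFin a))

Switching : ∀ {b d} → (Fin b → Fin d) → (Fin b → Fin d) → Set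
Switching {b} f f' = ∃₂ λ (x y : Fin b) →
  (f' x ≡ f y) × (f' y ≡ f x) × (∀ w → w ≢ x → w ≢ y → f' w ≡ f w)

-- SwWithin s f f' : f' is obtained from f by a sequence of at most s switchings
-- (functions compared pointwise).
data SwWithin {b d : ℕ} : ℕ → (Fin b → Fin d) → (Fin b → Fin d) → Set where
  done : ∀ {s f f'} → (∀ x → f x ≡ f' x) → SwWithin s f f'
  step : ∀ {s f g h} → Switching f g → SwWithin s g h → SwWithin (suc s) f h

module Submission where

-- Whether u is an f-candidate for ũ depends only on the values of f on
-- N_H(ũ).  A single switching changes f only at two points x and y, so the
-- candidate neighbourhood of ũ can change only if ũ is adjacent to x or y;
-- there are at most deg(x) + deg(y) ≤ 2Δ such ũ.  Since ndist is a pseudometric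
-- (it satisfies the triangle inequality), s switchings change at most 2sΔ
-- candidate neighbourhoods.

open import Defs
open import Data.Nat using (ℕ; suc; _≤_; _+_; _*_; z≤n; s≤s)
open import Data.Nat.Properties
  using (≤-trans; ≤-reflexive; m≤n⇒m≤1+n; +-suc; +-mono-≤; +-identityʳ; *-suc; *-distribʳ-+; module ≤-Reasoning)
open import Data.Fin using (Fin)
open import Data.Bool using (Bool; true; false; T; not; _∨_; _xor_)
open import Data.Bool.Properties using (T-∨; xor-same)
open import Data.List using (List; []; _∷_; length; filterᵇ; allFin)
open import Data.List.Properties using (map-cong)
open import Data.Bool.ListAction using (any; and)
open import Data.List.Relation.Unary.Any as Any using ()
open import Data.List.Relation.Unary.Any.Properties using (any⁺; any⁻; Any-⊎⁻)
open import Data.Sum using (_⊎_; inj₁; inj₂)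
import Data.Sum as Sum
open import Data.Product using (_,_)
open import Data.Unit using (tt)
open import Data.Empty using (⊥-elim)
open import Function.Bundles using (Equivalence)
open import Function.Definitions using (Injective)
open import Relation.Nullary using (¬_)
open import Relation.Binary.PropositionalEquality using (_≡_; _≢_; refl; sym; cong; subst)

count : ∀ {A : Set} → (A → Bool) → List A → ℕ
count p xs = length (filterᵇ p xs)

count-mono : ∀ {A : Set} {p q : A → Bool} → (∀ x → T (p x) → T (q x))
           → ∀ xs → count p xs ≤ count q xs
count-mono p⇒q [] = z≤n
count-mono {p = p} {q} p⇒q (x ∷ xs) with p x | q x | p⇒q x
... | false | false | _     = count-mono p⇒q xs
... | false | true  | _     = m≤n⇒m≤1+n (count-mono p⇒q xs)
... | true  | true  | _     = s≤s (count-mono p⇒q xs)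
... | true  | false | px⇒qx = ⊥-elim (px⇒qx tt)

count-∨ : ∀ {A : Set} (p q : A → Bool) xs
        → count (λ x → p x ∨ q x) xs ≤ count p xs + count q xs
count-∨ p q [] = z≤n
count-∨ p q (x ∷ xs) with p x | q x
... | false | false = count-∨ p q xs
... | false | true  rewrite +-suc (count p xs) (count q xs) = s≤s (count-∨ p q xs)
... | true  | false = s≤s (count-∨ p q xs)
... | true  | true  rewrite +-suc (count p xs) (count q xs) =
  s≤s (m≤n⇒m≤1+n (count-∨ p q xs))

count-none : ∀ {A : Set} {p : A → Bool} → (∀ x → ¬ T (p x)) → ∀ xs → count p xs ≡ 0
count-none never [] = refl
count-none {p = p} never (x ∷ xs) with p x | never x
... | false | _   = count-none never xs
... | true  | ¬px = ⊥-elim (¬px tt)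

xor-triangle : ∀ x y z → T (x xor z) → T (x xor y) ⊎ T (y xor z)
xor-triangle true  true  false _ = inj₂ tt
xor-triangle true  false false _ = inj₁ tt
xor-triangle false true  true  _ = inj₁ tt
xor-triangle false false true  _ = inj₂ tt

module NeighbourhoodDistance {a c : ℕ} where

  differs : BipGraph a c → BipGraph a c → Fin a → Bool
  differs B B' ũ = any (λ u → B ũ u xor B' ũ u) (allFin c)

  agree⇒¬differs : ∀ (B B' : BipGraph a c) ũ → (∀ u → B ũ u ≡ B' ũ u)
                 → ¬ T (differs B B' ũ)
  agree⇒¬differs B B' ũ agree d with Any.satisfied (any⁻ _ (allFin c) d)
  ... | u , Bu≠B'u = subst T (xor-same (B' ũ u)) (subst (λ z → T (z xor B' ũ u)) (agree u) Bu≠B'u)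

  ndist-≗ : ∀ (B B' : BipGraph a c) → (∀ ũ u → B ũ u ≡ B' ũ u) → ndist B B' ≡ 0
  ndist-≗ B B' agree = count-none (λ ũ → agree⇒¬differs B B' ũ (agree ũ)) (allFin a)

  -- Triangle inequality: a neighbourhood differing between B₁ and B₃ differs
  -- between B₁ and B₂ or between B₂ and B₃.
  ndist-triangle : ∀ (B₁ B₂ B₃ : BipGraph a c)
                 → ndist B₁ B₃ ≤ ndist B₁ B₂ + ndist B₂ B₃
  ndist-triangle B₁ B₂ B₃ =
    ≤-trans (count-mono differs-split (allFin a)) (count-∨ (differs B₁ B₂) (differs B₂ B₃) (allFin a))
    where
    differs-split : ∀ ũ → T (differs B₁ B₃ ũ) → T (differs B₁ B₂ ũ ∨ differs B₂ B₃ ũ)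
    differs-split ũ d =
      Equivalence.from T-∨ (Sum.map (any⁺ _) (any⁺ _) (Any-⊎⁻
        (Any.map (λ {u} → xor-triangle (B₁ ũ u) (B₂ ũ u) (B₃ ũ u)) (any⁻ _ (allFin c) d))))

open NeighbourhoodDistance

module CandidateGraph {a b c d : ℕ} (H : BipGraph a b) (G : BipGraph c d) where

  candidate-local : ∀ (f g : Fin b → Fin d) ũ → (∀ ṽ → T (H ũ ṽ) → f ṽ ≡ g ṽ)
                  → ∀ u → candidateGraph H G f ũ u ≡ candidateGraph H G g ũ u
  candidate-local f g ũ agree u = cong and (map-cong condition (allFin b))
    where
    condition : ∀ ṽ → (not (H ũ ṽ) ∨ G u (f ṽ)) ≡ (not (H ũ ṽ) ∨ G u (g ṽ))
    condition ṽ with H ũ ṽ | agree ṽ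
    ... | true  | fṽ≡gṽ = cong (G u) (fṽ≡gṽ tt)
    ... | false | _     = refl

  ndist-pointwise : ∀ (f g : Fin b → Fin d) → (∀ ṽ → f ṽ ≡ g ṽ)
                  → ndist (candidateGraph H G f) (candidateGraph H G g) ≡ 0
  ndist-pointwise f g f≗g =
    ndist-≗ (candidateGraph H G f) (candidateGraph H G g) (λ ũ → candidate-local f g ũ (λ ṽ _ → f≗g ṽ))

  -- Changing f at two points x, y changes only neighbourhoods of vertices
  -- adjacent to x or y, hence at most deg(x) + deg(y) of them.
  ndist-two-point-change : ∀ (f g : Fin b → Fin d) x y → (∀ w → w ≢ x → w ≢ y → g w ≡ f w)
    → ndist (candidateGraph H G f) (candidateGraph H G g) ≤ degʳ H x + degʳ H y
  ndist-two-point-change f g x y unchanged =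
    ≤-trans (count-mono touches (allFin a)) (count-∨ (λ ũ → H ũ x) (λ ũ → H ũ y) (allFin a))
    where
    touches : ∀ ũ → T (differs (candidateGraph H G f) (candidateGraph H G g) ũ)
            → T (H ũ x ∨ H ũ y)
    touches ũ dif with H ũ x in ũx | H ũ y in ũy
    ... | true  | _     = tt
    ... | false | true  = tt
    ... | false | false = agree⇒¬differs (candidateGraph H G f) (candidateGraph H G g) ũ (candidate-local f g ũ agree) dif
      where
      agree : ∀ ṽ → T (H ũ ṽ) → f ṽ ≡ g ṽ
      agree ṽ adj = sym (unchanged ṽ (λ { refl → subst T ũx adj }) (λ { refl → subst T ũy adj }))

  ndist-switching : ∀ Δ → (∀ ṽ → degʳ H ṽ ≤ Δ) → ∀ f g → Switching f g
                  → ndist (candidateGraph H G f) (candidateGraph H G g) ≤ 2 * Δ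
  ndist-switching Δ deg≤Δ f g (x , y , _ , _ , unchanged) = begin
    ndist (candidateGraph H G f) (candidateGraph H G g) ≤⟨ ndist-two-point-change f g x y unchanged ⟩
    degʳ H x + degʳ H y                                 ≤⟨ +-mono-≤ (deg≤Δ x) (deg≤Δ y) ⟩
    Δ + Δ                                               ≡⟨ cong (Δ +_) (sym (+-identityʳ Δ)) ⟩
    2 * Δ                                               ∎
    where open ≤-Reasoning

  ndist-switchings : ∀ Δ → (∀ ṽ → degʳ H ṽ ≤ Δ) → ∀ {s f g} → SwWithin s f g
                   → ndist (candidateGraph H G f) (candidateGraph H G g) ≤ 2 * s * Δ
  ndist-switchings Δ deg≤Δ {f = f} {g} (done f≗g) = ≤-trans (≤-reflexive (ndist-pointwise f g f≗g)) z≤n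
  ndist-switchings Δ deg≤Δ {suc s} {f} {h} (step {g = g} f~g g~h) = begin
    ndist (candidateGraph H G f) (candidateGraph H G h)
      ≤⟨ ndist-triangle (candidateGraph H G f) (candidateGraph H G g) (candidateGraph H G h) ⟩
    ndist (candidateGraph H G f) (candidateGraph H G g) + ndist (candidateGraph H G g) (candidateGraph H G h)
      ≤⟨ +-mono-≤ (ndist-switching Δ deg≤Δ f g f~g) (ndist-switchings Δ deg≤Δ g~h) ⟩
    2 * Δ + 2 * s * Δ
      ≡⟨ sym (*-distribʳ-+ Δ 2 (2 * s)) ⟩
    (2 + 2 * s) * Δ
      ≡⟨ cong (_* Δ) (sym (*-suc 2 s)) ⟩
    2 * suc s * Δ
      ∎
    where open ≤-Reasoning

open CandidateGraph

lemma11p4 : ∀ {a b c d : ℕ} (H : BipGraph a b) (G : BipGraph c d) (Δ s : ℕ)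
    → (∀ ṽ → degʳ H ṽ ≤ Δ)
    → (f f' : Fin b → Fin d) → Injective _≡_ _≡_ f → Injective _≡_ _≡_ f'
    → SwWithin s f f'
    → ndist (candidateGraph H G f) (candidateGraph H G f') ≤ 2 * s * Δ
lemma11p4 H G Δ s deg≤Δ f f' _ _ switchings = ndist-switchings H G Δ deg≤Δ switchings
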